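{- Let $G$ be a finite connected simple graph and let $\beta$ be a solution for the Naji system of $G$. If $\beta$ is chordal, then, up to equivalence, there is a unique oriented chord diagram for $(G,\beta)$.
   Context: The Naji system of a graph $G=(V,E)$ has unknowns $\beta(u,v)\in\mathbb{F}_2$ for each ordered pair of distinct vertices, and equations: $\beta(v,w)+\beta(w,v)=1$ for each edge $vw$; $\beta(x,v)+\beta(x,w)=0$ for each triple of distinct vertices $(x,v,w)$ with $vw\in E$, $xv,xw\notin E$; $\beta(v,w)+\beta(w,v)+\beta(x,v)+\beta(x,w)=1$ for each triple of distinct vertices $(x,v,w)$ with $xv,xw\in E$, $vw\notin E$. An oriented chord diagram is a circle with finitely many oriented chords (tail and head) with pairwise distinct endpoints. For an oriented chord diagram $\vec{\mathcal C}$ whose intersection graph is $G$ (chords identified with vertices, adjacent iff crossing), $\beta_{\vec{\mathcal C}}(v,w)=0$ if the head of $w$ is encountered travelling clockwise from the head of $v$ to the tail of $v$, and $1$ otherwise; $\vec{\mathcal C}$ is an oriented chord diagram for $(G,\beta)$ if its intersection graph is $G$ and $\beta_{\vec{\mathcal C}}=\beta$; $\beta$ is chordal if such a diagram exists. Two oriented chord diagrams are equivalent if, traversing the circle clockwise and recording for each chord endpoint met the name of the chord and whether it is a head or a tail, one obtains the same cyclic sequence. -}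

module Defs where

open import Data.Nat using (ℕ; _<_)
open import Data.Fin using (Fin)
open import Data.Bool using (Bool; true; false; _xor_)
open import Data.Product using (_×_; _,_; ∃; ∃-syntax; Σ)
open import Data.Sum using (_⊎_)
open import Data.List using (List; length; lookup; take; drop; _++_)
open import Data.List.Membership.Propositional using (_∈_)
open import Data.List.Relation.Unary.Unique.Propositional using (Unique)
open import Relation.Nullary using (¬_)
open import Relation.Binary.PropositionalEquality using (_≡_; _≢_)
open import Relation.Binary.Construct.Closure.ReflexiveTransitive using (Star)
open import Function.Bundles using (_⇔_)
open import Level using (0ℓ; suc)

record Graph (n : ℕ) : Set₁ where
  field
    E     : Fin n → Fin n → Set
    sym   : ∀ {u v} → E u v → E v u
    irrefl : ∀ {u} → ¬ E u u
open Graph public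

Connected : ∀ {n} → Graph n → Set
Connected G = ∀ u v → Star (E G) u v

-- The Naji system over F₂ (F₂ = Bool, addition = _xor_)

Beta : ℕ → Set
Beta n = Fin n → Fin n → Bool

record NajiSolution {n : ℕ} (G : Graph n) (β : Beta n) : Set where
  field
    edgeEq : ∀ v w → E G v w → (β v w xor β w v) ≡ true
    nonAdjEq : ∀ x v w → x ≢ v → x ≢ w → v ≢ w →
      E G v w → ¬ E G x v → ¬ E G x w →
      (β x v xor β x w) ≡ false
    adjEq : ∀ x v w → x ≢ v → x ≢ w → v ≢ w →
      E G x v → E G x w → ¬ E G v w →
      (β v w xor β w v xor β x v xor β x w) ≡ true

-- A diagram is the sequence of chord endpoints met travelling
-- clockwise around the circle from some base point; each endpoint
-- (chord, head/tail) occurs exactly once.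

data End : Set where
  head tail : End

Endpoint : ℕ → Set
Endpoint n = Fin n × End

record ChordDiagram (n : ℕ) : Set where
  field
    seq      : List (Endpoint n)
    unique   : Unique seq
    complete : ∀ (p : Endpoint n) → p ∈ seq
open ChordDiagram public

Before : ∀ {n} → ChordDiagram n → Endpoint n → Endpoint n → Set
Before D a b = ∃[ i ] ∃[ j ] (Data.Fin._<_ i j × lookup (seq D) i ≡ a × lookup (seq D) j ≡ b)

-- p is encountered travelling clockwise (strictly) from s to e
InArc : ∀ {n} → ChordDiagram n → Endpoint n → Endpoint n → Endpoint n → Set
InArc D s e p =
  (Before D s e × Before D s p × Before D p e)
  ⊎ (Before D e s × (Before D s p ⊎ Before D p e))

Cross : ∀ {n} → ChordDiagram n → Fin n → Fin n → Set
Cross D v w =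
  (InArc D (v , head) (v , tail) (w , head) × ¬ InArc D (v , head) (v , tail) (w , tail))
  ⊎ (¬ InArc D (v , head) (v , tail) (w , head) × InArc D (v , head) (v , tail) (w , tail))

HasIntersectionGraph : ∀ {n} → ChordDiagram n → Graph n → Set
HasIntersectionGraph D G = ∀ v w → v ≢ w → (E G v w ⇔ Cross D v w)

-- β_D(v,w) = 0 iff the head of w is met going clockwise from head of v to tail of v
-- (β_D is defined for distinct v, w)
BetaMatches : ∀ {n} → ChordDiagram n → Beta n → Set
BetaMatches D β = ∀ v w → v ≢ w →
  (β v w ≡ false ⇔ InArc D (v , head) (v , tail) (w , head))

IsDiagramFor : ∀ {n} → ChordDiagram n → Graph n → Beta n → Set
IsDiagramFor D G β = HasIntersectionGraph D G × BetaMatches D β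

Chordal : ∀ {n} → Graph n → Beta n → Set
Chordal {n} G β = Σ (ChordDiagram n) λ D → IsDiagramFor D G β

-- equivalence: same cyclic sequence, i.e. one sequence is a rotation of the other
rotate : ∀ {A : Set} → ℕ → List A → List A
rotate k xs = drop k xs ++ take k xs

Equivalent : ∀ {n} → ChordDiagram n → ChordDiagram n → Set
Equivalent D D′ = ∃[ k ] (rotate k (seq D) ≡ seq D′)

module Submission where

-- A diagram is read as a list of endpoints; what matters up to rotation is the
-- cyclic order of its endpoints.  The proof shows that any two diagrams D₁, D₂
-- for (G, β) induce the same cyclic order, and then that two duplicate-free
-- complete lists with the same cyclic order are rotations of each other.

open import Defs
open import Data.Bool using (Bool; true; false)
open import Data.Empty using (⊥; ⊥-elim)
open import Data.Fin as Fin using (Fin; toℕ)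
open import Data.Fin.Properties using (toℕ<n; toℕ-injective; nonZeroIndex; any?)
open import Data.List using (List; []; _∷_; _++_; length; lookup; take; drop)
open import Data.List.Membership.Propositional using (_∈_; _∉_)
open import Data.List.Membership.Propositional.Properties using (∈-lookup; ∈-++⁺ˡ; ∈-++⁺ʳ; ∈-++⁻; ∈-∃++)
open import Data.List.Relation.Binary.Permutation.Propositional using (↭⇒↭ₛ)
open import Data.List.Relation.Binary.Permutation.Propositional.Properties using (++-comm; ∈-resp-↭)
import Data.List.Relation.Binary.Permutation.Setoid.Properties as PermSetoid
open import Data.List.Relation.Unary.Any using (here; there; index)
open import Data.List.Relation.Unary.Any.Properties using (lookup-index)
open import Data.List.Relation.Unary.AllPairs using (_∷_)
open import Data.List.Relation.Unary.Unique.Propositional using (Unique)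
open import Data.List.Relation.Unary.Unique.Propositional.Properties using (Unique[x∷xs]⇒x∉xs)
open import Data.Nat using (ℕ; zero; suc; _+_; _*_; _<_; _≤_; z≤n; s≤s; _%_; NonZero)
open import Data.Nat.DivMod using ([m+kn]%n≡m%n; m<n⇒m%n≡m)
import Data.Nat.Properties as ℕₚ
open import Data.Product using (_×_; _,_; Σ; ∃-syntax; proj₁; proj₂)
open import Data.Product.Properties using (≡-dec)
open import Data.Sum using (_⊎_; inj₁; inj₂)
open import Function.Bundles using (Equivalence)
open import Relation.Binary.Construct.Closure.ReflexiveTransitive using (Star; ε; _◅_)
open import Relation.Binary.PropositionalEquality as ≡ using (_≡_; _≢_; refl)
open import Relation.Nullary using (¬_; Dec; yes; no; does)
open import Relation.Nullary.Decidable using (_×-dec_; _⊎-dec_; ¬?; map′)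

open Equivalence using (to; from)

module Precedence {A : Set} where

  Precedes : List A → A → A → Set
  Precedes []       _ _ = ⊥
  Precedes (x ∷ xs) a b = (x ≡ a × b ∈ xs) ⊎ Precedes xs a b

  precedes-∈ˡ : ∀ {xs a b} → Precedes xs a b → a ∈ xs
  precedes-∈ˡ {x ∷ xs} (inj₁ (refl , _)) = here refl
  precedes-∈ˡ {x ∷ xs} (inj₂ a<b)        = there (precedes-∈ˡ a<b)

  precedes-∈ʳ : ∀ {xs a b} → Precedes xs a b → b ∈ xs
  precedes-∈ʳ {x ∷ xs} (inj₁ (_ , b∈xs)) = there b∈xs
  precedes-∈ʳ {x ∷ xs} (inj₂ a<b)        = there (precedes-∈ʳ a<b)

  precedes-irrefl : ∀ {xs a} → Unique xs → ¬ Precedes xs a a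
  precedes-irrefl {x ∷ xs} u       (inj₁ (refl , x∈xs)) = Unique[x∷xs]⇒x∉xs u x∈xs
  precedes-irrefl {x ∷ xs} (_ ∷ u) (inj₂ a<a)           = precedes-irrefl u a<a

  precedes-trans : ∀ {xs a b c} → Unique xs → Precedes xs a b → Precedes xs b c → Precedes xs a c
  precedes-trans {x ∷ xs} u (inj₁ (refl , b∈xs)) (inj₁ (refl , _)) = ⊥-elim (Unique[x∷xs]⇒x∉xs u b∈xs)
  precedes-trans {x ∷ xs} u (inj₁ (refl , _))    (inj₂ b<c)        = inj₁ (refl , precedes-∈ʳ b<c)
  precedes-trans {x ∷ xs} u (inj₂ a<b)           (inj₁ (refl , _)) = ⊥-elim (Unique[x∷xs]⇒x∉xs u (precedes-∈ʳ a<b))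
  precedes-trans {x ∷ xs} (_ ∷ u) (inj₂ a<b)     (inj₂ b<c)        = inj₂ (precedes-trans u a<b b<c)

  precedes-total : ∀ {xs a b} → a ≢ b → a ∈ xs → b ∈ xs → Precedes xs a b ⊎ Precedes xs b a
  precedes-total a≢b (here refl) (here refl)  = ⊥-elim (a≢b refl)
  precedes-total a≢b (here refl) (there b∈xs) = inj₁ (inj₁ (refl , b∈xs))
  precedes-total a≢b (there a∈xs) (here refl) = inj₂ (inj₁ (refl , a∈xs))
  precedes-total a≢b (there a∈xs) (there b∈xs) with precedes-total a≢b a∈xs b∈xs
  ... | inj₁ a<b = inj₁ (inj₂ a<b)
  ... | inj₂ b<a = inj₂ (inj₂ b<a)

  precedes-++ˡ : ∀ {xs ys a b} → Precedes xs a b → Precedes (xs ++ ys) a b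
  precedes-++ˡ {x ∷ xs} (inj₁ (x≡a , b∈xs)) = inj₁ (x≡a , ∈-++⁺ˡ b∈xs)
  precedes-++ˡ {x ∷ xs} (inj₂ a<b)          = inj₂ (precedes-++ˡ a<b)

  precedes-++ʳ : ∀ xs {ys a b} → Precedes ys a b → Precedes (xs ++ ys) a b
  precedes-++ʳ []       a<b = a<b
  precedes-++ʳ (x ∷ xs) a<b = inj₂ (precedes-++ʳ xs a<b)

  precedes-++-across : ∀ {xs ys a b} → a ∈ xs → b ∈ ys → Precedes (xs ++ ys) a b
  precedes-++-across {x ∷ xs} (here refl)  b∈ys = inj₁ (refl , ∈-++⁺ʳ xs b∈ys)
  precedes-++-across {x ∷ xs} (there a∈xs) b∈ys = inj₂ (precedes-++-across a∈xs b∈ys)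

  precedes-++⁻ : ∀ xs {ys a b} → Precedes (xs ++ ys) a b →
    Precedes xs a b ⊎ Precedes ys a b ⊎ (a ∈ xs × b ∈ ys)
  precedes-++⁻ []       a<b = inj₂ (inj₁ a<b)
  precedes-++⁻ (x ∷ xs) (inj₁ (refl , b∈xs++ys)) with ∈-++⁻ xs b∈xs++ys
  ... | inj₁ b∈xs = inj₁ (inj₁ (refl , b∈xs))
  ... | inj₂ b∈ys = inj₂ (inj₂ (here refl , b∈ys))
  precedes-++⁻ (x ∷ xs) (inj₂ a<b) with precedes-++⁻ xs a<b
  ... | inj₁ a<b′                  = inj₁ (inj₂ a<b′)
  ... | inj₂ (inj₁ a<b′)           = inj₂ (inj₁ a<b′)
  ... | inj₂ (inj₂ (a∈xs , b∈ys))  = inj₂ (inj₂ (there a∈xs , b∈ys))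

  index⇒precedes : ∀ (xs : List A) {i j : Fin (length xs)} {a b} →
    i Fin.< j → lookup xs i ≡ a → lookup xs j ≡ b → Precedes xs a b
  index⇒precedes (x ∷ xs) {Fin.zero}  {Fin.suc j} _         refl refl = inj₁ (refl , ∈-lookup j)
  index⇒precedes (x ∷ xs) {Fin.suc i} {Fin.suc j} (s≤s i<j) ea   eb   = inj₂ (index⇒precedes xs i<j ea eb)

  precedes⇒index : ∀ (xs : List A) {a b} → Precedes xs a b →
    ∃[ i ] ∃[ j ] (i Fin.< j × lookup xs i ≡ a × lookup xs j ≡ b)
  precedes⇒index (x ∷ xs) (inj₁ (refl , b∈xs)) =
    Fin.zero , Fin.suc (index b∈xs) , s≤s z≤n , refl , ≡.sym (lookup-index b∈xs)
  precedes⇒index (x ∷ xs) (inj₂ a<b) with precedes⇒index xs a<b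
  ... | i , j , i<j , ea , eb = Fin.suc i , Fin.suc j , s≤s i<j , ea , eb

-- The cyclic order induced by a strict total order: Cyclic _<_ a b c says that
-- a, b, c are met in this order when the line is closed up into a circle.
Cyclic : {A : Set} → (A → A → Set) → A → A → A → Set
Cyclic _<_ a b c = (a < b × b < c) ⊎ (b < c × c < a) ⊎ (c < a × a < b)

module CyclicOrder {A : Set} (_<_ : A → A → Set)
  (irreflexive : ∀ {a} → ¬ a < a)
  (transitive  : ∀ {a b c} → a < b → b < c → a < c)
  (total       : ∀ {a b} → a ≢ b → a < b ⊎ b < a)
  (_≟_         : (a b : A) → Dec (a ≡ b)) where

  Cyc : A → A → A → Set
  Cyc = Cyclic _<_

  private
    asym₂ : ∀ {a b} → a < b → ¬ b < a
    asym₂ a<b b<a = irreflexive (transitive a<b b<a)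

  rot : ∀ {a b c} → Cyc a b c → Cyc b c a
  rot (inj₁ o)        = inj₂ (inj₂ o)
  rot (inj₂ (inj₁ o)) = inj₁ o
  rot (inj₂ (inj₂ o)) = inj₂ (inj₁ o)

  rot² : ∀ {a b c} → Cyc a b c → Cyc c a b
  rot² o = rot (rot o)

  asym : ∀ {a b c} → Cyc a b c → ¬ Cyc c b a
  asym (inj₁ (ab , bc))        (inj₁ (cb , ba))        = asym₂ bc cb
  asym (inj₁ (ab , bc))        (inj₂ (inj₁ (ba , ac))) = asym₂ ab ba
  asym (inj₁ (ab , bc))        (inj₂ (inj₂ (ac , cb))) = asym₂ bc cb
  asym (inj₂ (inj₁ (bc , ca))) (inj₁ (cb , ba))        = asym₂ bc cb
  asym (inj₂ (inj₁ (bc , ca))) (inj₂ (inj₁ (ba , ac))) = asym₂ ca ac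
  asym (inj₂ (inj₁ (bc , ca))) (inj₂ (inj₂ (ac , cb))) = asym₂ ca ac
  asym (inj₂ (inj₂ (ca , ab))) (inj₁ (cb , ba))        = asym₂ ab ba
  asym (inj₂ (inj₂ (ca , ab))) (inj₂ (inj₁ (ba , ac))) = asym₂ ab ba
  asym (inj₂ (inj₂ (ca , ab))) (inj₂ (inj₂ (ac , cb))) = asym₂ ca ac

  anti : ∀ {a b c} → Cyc a b c → ¬ Cyc a c b
  anti o o′ = asym o (rot o′)

  distinct₁₃ : ∀ {a b c} → Cyc a b c → a ≢ c
  distinct₁₃ o refl = asym o o

  distinct₁₂ : ∀ {a b c} → Cyc a b c → a ≢ b
  distinct₁₂ o refl = asym (rot o) (rot o)

  distinct₂₃ : ∀ {a b c} → Cyc a b c → b ≢ c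
  distinct₂₃ o refl = asym (rot² o) (rot² o)

  trans-from : ∀ {a b c d} → Cyc a b c → Cyc a c d → Cyc a b d
  trans-from (inj₁ (ab , bc))        (inj₁ (ac , cd))        = inj₁ (ab , transitive bc cd)
  trans-from (inj₁ (ab , bc))        (inj₂ (inj₁ (cd , da))) = ⊥-elim (asym₂ (transitive ab bc) (transitive cd da))
  trans-from (inj₁ (ab , bc))        (inj₂ (inj₂ (da , ac))) = inj₂ (inj₂ (da , ab))
  trans-from (inj₂ (inj₁ (bc , ca))) (inj₁ (ac , cd))        = ⊥-elim (asym₂ ac ca)
  trans-from (inj₂ (inj₁ (bc , ca))) (inj₂ (inj₁ (cd , da))) = inj₂ (inj₁ (transitive bc cd , da))
  trans-from (inj₂ (inj₁ (bc , ca))) (inj₂ (inj₂ (da , ac))) = ⊥-elim (asym₂ ac ca)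
  trans-from (inj₂ (inj₂ (ca , ab))) (inj₁ (ac , cd))        = ⊥-elim (asym₂ ac ca)
  trans-from (inj₂ (inj₂ (ca , ab))) (inj₂ (inj₁ (cd , da))) = inj₂ (inj₂ (da , ab))
  trans-from (inj₂ (inj₂ (ca , ab))) (inj₂ (inj₂ (da , ac))) = ⊥-elim (asym₂ ac ca)

  orient : ∀ {a b c} → a ≢ b → b ≢ c → a ≢ c → Cyc a b c ⊎ Cyc c b a
  orient a≢b b≢c a≢c with total a≢b | total b≢c
  ... | inj₁ ab | inj₁ bc = inj₁ (inj₁ (ab , bc))
  ... | inj₂ ba | inj₂ cb = inj₂ (inj₁ (cb , ba))
  ... | inj₁ ab | inj₂ cb with total a≢c
  ...   | inj₁ ac = inj₂ (inj₂ (inj₂ (ac , cb)))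
  ...   | inj₂ ca = inj₁ (inj₂ (inj₂ (ca , ab)))
  orient a≢b b≢c a≢c | inj₂ ba | inj₁ bc with total a≢c
  ...   | inj₁ ac = inj₂ (inj₂ (inj₁ (ba , ac)))
  ...   | inj₂ ca = inj₁ (inj₂ (inj₁ (bc , ca)))

  swap : ∀ {a b c} → a ≢ b → b ≢ c → a ≢ c → ¬ Cyc a b c → Cyc a c b
  swap a≢b b≢c a≢c ¬o with orient a≢b b≢c a≢c
  ... | inj₁ o  = ⊥-elim (¬o o)
  ... | inj₂ o′ = rot² o′

  cyc? : ∀ a b c → Dec (Cyc a b c)
  cyc? a b c with a ≟ b | b ≟ c | a ≟ c
  ... | yes a≡b | _       | _       = no λ o → distinct₁₂ o a≡b
  ... | no _    | yes b≡c | _       = no λ o → distinct₂₃ o b≡c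
  ... | no _    | no _    | yes a≡c = no λ o → distinct₁₃ o a≡c
  ... | no a≢b  | no b≢c  | no a≢c with orient a≢b b≢c a≢c
  ...   | inj₁ o  = yes o
  ...   | inj₂ o′ = no λ o → asym o o′

  trans-shift : ∀ {a b c d} → Cyc a b c → Cyc a c d → Cyc b c d
  trans-shift abc acd with orient (distinct₁₂ (rot abc)) (distinct₁₂ (rot acd)) (distinct₂₃ (trans-from abc acd))
  ... | inj₁ bcd = bcd
  ... | inj₂ dcb = ⊥-elim (asym abc (trans-from (rot dcb) (rot acd)))

  -- The orientation of x y z is determined by the orientations relative to
  -- any fourth point a.
  BasedAt : A → A → A → A → Set
  BasedAt a x y z = (Cyc a x y × Cyc a y z) ⊎ (Cyc a y z × Cyc a z x) ⊎ (Cyc a z x × Cyc a x y)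

  based-at⇒cyc : ∀ {a x y z} → BasedAt a x y z → Cyc x y z
  based-at⇒cyc (inj₁ (axy , ayz))        = trans-shift axy ayz
  based-at⇒cyc (inj₂ (inj₁ (ayz , azx))) = rot² (trans-shift ayz azx)
  based-at⇒cyc (inj₂ (inj₂ (azx , axy))) = rot (trans-shift azx axy)

  cyc⇒based-at : ∀ {a x y z} → a ≢ x → a ≢ y → a ≢ z → Cyc x y z → BasedAt a x y z
  cyc⇒based-at a≢x a≢y a≢z xyz
    with orient a≢x (distinct₁₂ xyz) a≢y | orient a≢y (distinct₂₃ xyz) a≢z | orient a≢z (distinct₁₂ (rot² xyz)) a≢x
  ... | inj₁ axy | inj₁ ayz | _        = inj₁ (axy , ayz)
  ... | _        | inj₁ ayz | inj₁ azx = inj₂ (inj₁ (ayz , azx))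
  ... | inj₁ axy | _        | inj₁ azx = inj₂ (inj₂ (azx , axy))
  ... | inj₂ yxa | inj₂ zya | inj₂ xza = ⊥-elim (anti (trans-from (rot² yxa) (rot² xza)) (rot² zya))
  ... | inj₁ axy | inj₂ zya | inj₂ xza = ⊥-elim (anti xyz (trans-shift (rot² xza) (rot² zya)))
  ... | inj₂ yxa | inj₁ ayz | inj₂ xza = ⊥-elim (anti (rot xyz) (trans-shift (rot² yxa) (rot² xza)))
  ... | inj₂ yxa | inj₂ zya | inj₁ azx = ⊥-elim (asym xyz (trans-shift (rot² zya) (rot² yxa)))

  same-side : ∀ {p u₁ u₂ v v′} → Cyc p u₁ v → Cyc p u₂ v → Cyc p u₁ v′ → Cyc u₁ v u₂ → Cyc u₁ v′ u₂
  same-side pu₁v pu₂v pu₁v′ u₁vu₂ with orient (distinct₁₂ pu₁v) (distinct₁₃ u₁vu₂) (distinct₁₂ pu₂v)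
  ... | inj₁ pu₁u₂ = ⊥-elim (anti u₁vu₂ (trans-shift pu₁u₂ pu₂v))
  ... | inj₂ u₂u₁p = rot (trans-shift (rot² u₂u₁p) pu₁v′)

_≟ᴱ_ : (a b : End) → Dec (a ≡ b)
head ≟ᴱ head = yes refl
head ≟ᴱ tail = no λ ()
tail ≟ᴱ head = no λ ()
tail ≟ᴱ tail = yes refl

_≟ᴾ_ : ∀ {n} → (a b : Endpoint n) → Dec (a ≡ b)
_≟ᴾ_ = ≡-dec Fin._≟_ _≟ᴱ_

module DiagramOrder {n} (D : ChordDiagram n) where
  open Precedence

  _≺_ : Endpoint n → Endpoint n → Set
  _≺_ = Precedes (seq D)

  open CyclicOrder _≺_ (precedes-irrefl (unique D)) (precedes-trans (unique D))
    (λ a≢b → precedes-total a≢b (complete D _) (complete D _)) _≟ᴾ_ public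

  before⇒≺ : ∀ {a b} → Before D a b → a ≺ b
  before⇒≺ (i , j , i<j , ea , eb) = index⇒precedes (seq D) i<j ea eb

  ≺⇒before : ∀ {a b} → a ≺ b → Before D a b
  ≺⇒before = precedes⇒index (seq D)

  inArc⇒cyc : ∀ {s e p} → InArc D s e p → Cyc s p e
  inArc⇒cyc (inj₁ (_ , sp , pe))    = inj₁ (before⇒≺ sp , before⇒≺ pe)
  inArc⇒cyc (inj₂ (es , inj₁ sp))   = inj₂ (inj₂ (before⇒≺ es , before⇒≺ sp))
  inArc⇒cyc (inj₂ (es , inj₂ pe))   = inj₂ (inj₁ (before⇒≺ pe , before⇒≺ es))

  cyc⇒inArc : ∀ {s e p} → Cyc s p e → InArc D s e p
  cyc⇒inArc (inj₁ (sp , pe))        = inj₁ (≺⇒before (precedes-trans (unique D) sp pe) , ≺⇒before sp , ≺⇒before pe)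
  cyc⇒inArc (inj₂ (inj₁ (pe , es))) = inj₂ (≺⇒before es , inj₂ (≺⇒before pe))
  cyc⇒inArc (inj₂ (inj₂ (es , sp))) = inj₂ (≺⇒before es , inj₁ (≺⇒before sp))

  inArc? : ∀ s e p → Dec (InArc D s e p)
  inArc? s e p = map′ cyc⇒inArc inArc⇒cyc (cyc? s p e)

  cross? : ∀ v w → Dec (Cross D v w)
  cross? v w = (arc (w , head) ×-dec ¬? (arc (w , tail))) ⊎-dec (¬? (arc (w , head)) ×-dec arc (w , tail))
    where
    arc : ∀ q → Dec (InArc D (v , head) (v , tail) q)
    arc = inArc? (v , head) (v , tail)

  nested⇒¬cross : ∀ {p x y} → (∀ e e′ → Cyc p (x , e) (y , e′)) → ¬ Cross D x y
  nested⇒¬cross before (inj₁ (yh-in , ¬yt-in)) =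
    ¬yt-in (cyc⇒inArc (same-side (before head head) (before tail head) (before head tail) (inArc⇒cyc yh-in)))
  nested⇒¬cross before (inj₂ (¬yh-in , yt-in)) =
    ¬yh-in (cyc⇒inArc (same-side (before head tail) (before tail tail) (before head head) (inArc⇒cyc yt-in)))

adjacency? : ∀ {n} (G : Graph n) (D : ChordDiagram n) → HasIntersectionGraph D G → ∀ u v → Dec (E G u v)
adjacency? G D intersection u v with u Fin.≟ v
... | yes refl = no (irrefl G)
... | no u≢v   = map′ (from (intersection u v u≢v)) (to (intersection u v u≢v)) (DiagramOrder.cross? D u v)

-- For chords v ≠ w, the data (G, β) alone determines the cyclic
-- order of their four endpoints, so any two diagrams for (G, β) agree on it.
-- From the base point (v , head): β v w locates w's head relative to v, and
-- then the crossing relation locates w's tail.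
module Positions {n} (G : Graph n) (β : Beta n) (D₁ D₂ : ChordDiagram n)
  (i₁ : IsDiagramFor D₁ G β) (i₂ : IsDiagramFor D₂ G β) {v w : Fin n} (v≢w : v ≢ w) where

  module D₁ = DiagramOrder D₁
  module D₂ = DiagramOrder D₂

  head-position : D₁.Cyc (v , head) (w , head) (v , tail) → D₂.Cyc (v , head) (w , head) (v , tail)
  head-position o = D₂.inArc⇒cyc (to (proj₂ i₂ v w v≢w) (from (proj₂ i₁ v w v≢w) (D₁.cyc⇒inArc o)))

  head-position⁻ : D₂.Cyc (v , head) (w , head) (v , tail) → D₁.Cyc (v , head) (w , head) (v , tail)
  head-position⁻ o = D₁.inArc⇒cyc (to (proj₂ i₁ v w v≢w) (from (proj₂ i₂ v w v≢w) (D₂.cyc⇒inArc o)))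

  tail-position : D₁.Cyc (v , head) (w , tail) (v , tail) → D₂.Cyc (v , head) (w , tail) (v , tail)
  tail-position o with D₁.cyc? (v , head) (w , head) (v , tail)
  ... | yes h₁ with D₂.cyc? (v , head) (w , tail) (v , tail)
  ...   | yes o₂ = o₂
  ...   | no ¬o₂ = ⊥-elim (¬edge (from (proj₁ i₂ v w v≢w)
                     (inj₁ (D₂.cyc⇒inArc (head-position h₁) , λ t → ¬o₂ (D₂.inArc⇒cyc t)))))
    where
    -- in D₁ both ends of w lie on the arc of v
    ¬edge : ¬ E G v w
    ¬edge e with to (proj₁ i₁ v w v≢w) e
    ... | inj₁ (_ , ¬t) = ¬t (D₁.cyc⇒inArc o)
    ... | inj₂ (¬h , _) = ¬h (D₁.cyc⇒inArc h₁)
  -- in D₁ only the tail of w lies on the arc of v, so v and w cross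
  tail-position o | no ¬h₁
    with to (proj₁ i₂ v w v≢w) (from (proj₁ i₁ v w v≢w) (inj₂ ((λ h → ¬h₁ (D₁.inArc⇒cyc h)) , D₁.cyc⇒inArc o)))
  ... | inj₁ (h₂ , _) = ⊥-elim (¬h₁ (head-position⁻ (D₂.inArc⇒cyc h₂)))
  ... | inj₂ (_ , t₂) = D₂.inArc⇒cyc t₂

data NonBase {n} (v w : Fin n) : Endpoint n → Set where
  v-tail : NonBase v w (v , tail)
  w-head : NonBase v w (w , head)
  w-tail : NonBase v w (w , tail)

data EndOf {n} (v w : Fin n) : Endpoint n → Set where
  v-head : EndOf v w (v , head)
  other  : ∀ {x} → NonBase v w x → EndOf v w x

endOf : ∀ {n} {v w : Fin n} (x : Endpoint n) → proj₁ x ≡ v ⊎ proj₁ x ≡ w → EndOf v w x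
endOf (_ , head) (inj₁ refl) = v-head
endOf (_ , tail) (inj₁ refl) = other v-tail
endOf (_ , head) (inj₂ refl) = other w-head
endOf (_ , tail) (inj₂ refl) = other w-tail

nonBase-≢ : ∀ {n} {v w : Fin n} {x} → v ≢ w → NonBase v w x → (v , head) ≢ x
nonBase-≢ v≢w w-head refl = v≢w refl

module TwoChords {n} (G : Graph n) (β : Beta n) (D₁ D₂ : ChordDiagram n)
  (i₁ : IsDiagramFor D₁ G β) (i₂ : IsDiagramFor D₂ G β) {v w : Fin n} (v≢w : v ≢ w) where

  open Positions G β D₁ D₂ i₁ i₂ v≢w
  private
    w≢v : w ≢ v
    w≢v w≡v = v≢w (≡.sym w≡v)
    module Back        = Positions G β D₂ D₁ i₂ i₁ v≢w
    module Swapped     = Positions G β D₁ D₂ i₁ i₂ w≢v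
    module SwappedBack = Positions G β D₂ D₁ i₂ i₁ w≢v

  reversed : ∀ {a x y} → (D₂.Cyc a x y → D₁.Cyc a x y) → D₁.Cyc a y x → D₂.Cyc a y x
  reversed back o = D₂.swap (D₁.distinct₁₃ o) (λ e → D₁.distinct₂₃ o (≡.sym e)) (D₁.distinct₁₂ o)
                      (λ o₂ → D₁.anti o (back o₂))

  from-v-head : ∀ {x y} → NonBase v w x → NonBase v w y → D₁.Cyc (v , head) x y → D₂.Cyc (v , head) x y
  from-v-head v-tail v-tail o = ⊥-elim (D₁.distinct₂₃ o refl)
  from-v-head w-head w-head o = ⊥-elim (D₁.distinct₂₃ o refl)
  from-v-head w-tail w-tail o = ⊥-elim (D₁.distinct₂₃ o refl)
  from-v-head w-head v-tail o = head-position o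
  from-v-head v-tail w-head o = reversed Back.head-position o
  from-v-head w-tail v-tail o = tail-position o
  from-v-head v-tail w-tail o = reversed Back.tail-position o
  from-v-head w-tail w-head o = D₂.rot (Swapped.head-position (D₁.rot² o))
  from-v-head w-head w-tail o = reversed (λ o₂ → D₁.rot (SwappedBack.head-position (D₂.rot² o₂))) o

  agree : ∀ {x y z} → EndOf v w x → EndOf v w y → EndOf v w z → D₁.Cyc x y z → D₂.Cyc x y z
  agree v-head    v-head    _         o = ⊥-elim (D₁.distinct₁₂ o refl)
  agree v-head    (other _) v-head    o = ⊥-elim (D₁.distinct₁₃ o refl)
  agree (other _) v-head    v-head    o = ⊥-elim (D₁.distinct₂₃ o refl)
  agree v-head    (other y) (other z) o = from-v-head y z o
  agree (other x) v-head    (other z) o = D₂.rot² (from-v-head z x (D₁.rot o))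
  agree (other x) (other y) v-head    o = D₂.rot (from-v-head x y (D₁.rot² o))
  agree (other x) (other y) (other z) o =
    D₂.based-at⇒cyc (transport (D₁.cyc⇒based-at (nonBase-≢ v≢w x) (nonBase-≢ v≢w y) (nonBase-≢ v≢w z) o))
    where
    transport : D₁.BasedAt (v , head) _ _ _ → D₂.BasedAt (v , head) _ _ _
    transport (inj₁ (o₁ , o₂))        = inj₁ (from-v-head x y o₁ , from-v-head y z o₂)
    transport (inj₂ (inj₁ (o₁ , o₂))) = inj₂ (inj₁ (from-v-head y z o₁ , from-v-head z x o₂))
    transport (inj₂ (inj₂ (o₁ , o₂))) = inj₂ (inj₂ (from-v-head z x o₁ , from-v-head x y o₂))

-- Adding the chords
-- in order of rank, each new chord crosses one that is already present.
record Ranking {n} (G : Graph n) (r : Fin n) : Set where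
  field
    rank           : Fin n → ℕ
    rank-injective : ∀ {x y} → rank x ≡ rank y → x ≡ y
    parent         : ∀ y → y ≢ r → ∃[ x ] (E G x y × rank x < rank y)

  -- A colouring that is constant across the edges among the vertices of rank
  -- below m is constant on those vertices: follow parents down to r.
  constant-below : (f : Fin n → Bool) (m : ℕ) →
    (∀ {x y} → E G x y → rank x < m → rank y < m → f x ≡ f y) →
    ∀ x → rank x < m → f x ≡ f r
  constant-below f m same x x<m = descend (suc (rank x)) x (ℕₚ.n<1+n (rank x)) x<m
    where
    descend : ∀ k y → rank y < k → rank y < m → f y ≡ f r
    descend (suc k) y y<k y<m with y Fin.≟ r
    ... | yes refl = refl
    ... | no y≢r with parent y y≢r
    ...   | z , e , z<y = ≡.trans (≡.sym (same e z<m y<m)) (descend k z (ℕₚ.<-≤-trans z<y (ℕₚ.m<1+n⇒m≤n y<k)) z<m)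
      where
      z<m : rank z < m
      z<m = ℕₚ.<-trans z<y y<m

least : ∀ {P : ℕ → Set} → (∀ k → Dec (P k)) → ∀ {k} → P k → ∃[ m ] (P m × ∀ {j} → j < m → ¬ P j)
least P? {zero}  p = 0 , p , λ ()
least P? {suc k} p with P? 0
... | yes p₀ = 0 , p₀ , λ ()
... | no ¬p₀ with least (λ j → P? (suc j)) p
...   | m , pm , below = suc m , pm , λ { {zero} _ → ¬p₀ ; {suc j} (s≤s j<m) → below j<m }

-- Every connected graph with decidable adjacency has a ranking at each root:
-- order the vertices by breadth-first distance from r, ties broken by index.
module BreadthFirst {n} (G : Graph n) (adjacent? : ∀ u v → Dec (E G u v))
  (connected : Connected G) (r : Fin n) where

  Within : ℕ → Fin n → Set
  Within zero    y = y ≡ r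
  Within (suc k) y = Within k y ⊎ ∃[ x ] (Within k x × E G x y)

  within? : ∀ k y → Dec (Within k y)
  within? zero    y = y Fin.≟ r
  within? (suc k) y = within? k y ⊎-dec any? (λ x → within? k x ×-dec adjacent? x y)

  reachable : ∀ {k x y} → Within k x → Star (E G) x y → ∃[ k′ ] Within k′ y
  reachable {k} wx ε          = k , wx
  reachable     wx (e ◅ path) = reachable (inj₂ (_ , wx , e)) path

  distance-spec : ∀ y → ∃[ d ] (Within d y × ∀ {j} → j < d → ¬ Within j y)
  distance-spec y = least (λ k → within? k y) (proj₂ (reachable {0} refl (connected r y)))

  distance : Fin n → ℕ
  distance y = proj₁ (distance-spec y)

  distance-minimal : ∀ {k y} → Within k y → distance y ≤ k
  distance-minimal {k} {y} wy = ℕₚ.≮⇒≥ λ k<d → proj₂ (proj₂ (distance-spec y)) k<d wy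

  closer-neighbour : ∀ y → y ≢ r → ∃[ x ] (E G x y × distance x < distance y)
  closer-neighbour y y≢r with distance-spec y
  ... | zero  , refl                , _       = ⊥-elim (y≢r refl)
  ... | suc d , inj₁ wy             , minimal = ⊥-elim (minimal (ℕₚ.n<1+n d) wy)
  ... | suc d , inj₂ (x , wx , e)   , _       = x , e , s≤s (distance-minimal wx)

  rank : Fin n → ℕ
  rank y = toℕ y + distance y * n

  -- the index is recovered as rank y % n
  rank-injective : ∀ {x y} → rank x ≡ rank y → x ≡ y
  rank-injective {x} {y} eq = toℕ-injective (begin
    toℕ x           ≡⟨ m<n⇒m%n≡m (toℕ<n x) ⟨
    toℕ x % n       ≡⟨ [m+kn]%n≡m%n (toℕ x) (distance x) n ⟨
    rank x % n      ≡⟨ ≡.cong (_% n) eq ⟩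
    rank y % n      ≡⟨ [m+kn]%n≡m%n (toℕ y) (distance y) n ⟩
    toℕ y % n       ≡⟨ m<n⇒m%n≡m (toℕ<n y) ⟩
    toℕ y           ∎)
    where
    open ≡.≡-Reasoning
    instance
      n≢0 : NonZero n
      n≢0 = nonZeroIndex x

  rank-monotone : ∀ {x y} → distance x < distance y → rank x < rank y
  rank-monotone {x} {y} closer = begin-strict
    toℕ x + distance x * n  <⟨ ℕₚ.+-monoˡ-< (distance x * n) (toℕ<n x) ⟩
    suc (distance x) * n    ≤⟨ ℕₚ.*-monoˡ-≤ n closer ⟩
    distance y * n          ≤⟨ ℕₚ.m≤n+m (distance y * n) (toℕ y) ⟩
    rank y                  ∎
    where open ℕₚ.≤-Reasoning

  ranking : Ranking G r
  ranking = record
    { rank           = rank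
    ; rank-injective = rank-injective
    ; parent         = λ y y≢r → let x , e , closer = closer-neighbour y y≢r in x , e , rank-monotone closer
    }

no-three-ends : ∀ {n} {a b c : Endpoint n} → proj₁ a ≡ proj₁ b → proj₁ a ≡ proj₁ c →
  a ≢ b → b ≢ c → a ≢ c → ⊥
no-three-ends {a = _ , head} {_ , head} {_ , _}    refl refl a≢b _   _   = a≢b refl
no-three-ends {a = _ , tail} {_ , tail} {_ , _}    refl refl a≢b _   _   = a≢b refl
no-three-ends {a = _ , head} {_ , tail} {_ , head} refl refl _   _   a≢c = a≢c refl
no-three-ends {a = _ , head} {_ , tail} {_ , tail} refl refl _   b≢c _   = b≢c refl
no-three-ends {a = _ , tail} {_ , head} {_ , head} refl refl _   b≢c _   = b≢c refl
no-three-ends {a = _ , tail} {_ , head} {_ , tail} refl refl _   _   a≢c = a≢c refl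

-- By induction on m they agree on the triples
-- of endpoints whose chords have rank below m.
module GlobalAgreement {n} (G : Graph n) (β : Beta n) (D₁ D₂ : ChordDiagram n)
  (i₁ : IsDiagramFor D₁ G β) (i₂ : IsDiagramFor D₂ G β) {r : Fin n} (ρ : Ranking G r) where

  open Ranking ρ
  module D₁ = DiagramOrder D₁
  module D₂ = DiagramOrder D₂

  chord : Endpoint n → Fin n
  chord = proj₁

  height : Endpoint n → ℕ
  height q = rank (chord q)

  AgreeBelow : ℕ → Set
  AgreeBelow m = ∀ {a b c} → height a < m → height b < m → height c < m → D₁.Cyc a b c → D₂.Cyc a b c

  two-chords : ∀ {v w a b c} → v ≢ w → EndOf v w a → EndOf v w b → EndOf v w c → D₁.Cyc a b c → D₂.Cyc a b c
  two-chords v≢w = TwoChords.agree G β D₁ D₂ i₁ i₂ v≢w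

  -- The extension step: a new endpoint p cannot sit differently relative to two
  -- old endpoints a, b in the two diagrams.  Suppose it did, and call an old
  -- endpoint q separated if p, q, b are in cyclic order in D₁ but not in D₂, so
  -- that a is separated and b is not.  Separation never splits an old chord (by
  -- the two-chord lemma) nor distinguishes two crossing old chords (seen from p
  -- they would be nested), so by connectivity it is constant on old chords.
  module Extension (m : ℕ) (ih : AgreeBelow m) {p a b : Endpoint n}
    (p-new : ¬ height p < m) (a-old : height a < m) (b-old : height b < m)
    (o₁ : D₁.Cyc p a b) (¬o₂ : ¬ D₂.Cyc p a b) where

    p≢old : ∀ {q} → height q < m → p ≢ q
    p≢old q-old refl = p-new q-old

    chord-p≢old : ∀ {q} → height q < m → chord p ≢ chord q
    chord-p≢old q-old eq = p-new (≡.subst (λ z → rank z < m) (≡.sym eq) q-old)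

    Separated : Endpoint n → Set
    Separated q = D₁.Cyc p q b × ¬ D₂.Cyc p q b

    -- defined by matching (rather than with _×-dec_) so that `side` below
    -- computes when `separated?` is abstracted by `with`
    separated? : ∀ q → Dec (Separated q)
    separated? q with D₁.cyc? p q b | D₂.cyc? p q b
    ... | yes pqb₁ | no ¬pqb₂ = yes (pqb₁ , ¬pqb₂)
    ... | no ¬pqb₁ | _        = no λ s → ¬pqb₁ (proj₁ s)
    ... | yes _    | yes pqb₂ = no λ s → proj₂ s pqb₂

    separated-≢ : ∀ {u v} → Separated u → ¬ Separated v → u ≢ v
    separated-≢ su ¬sv refl = ¬sv su

    order₁ : ∀ {u v} → height u < m → height v < m → Separated u → ¬ Separated v → D₁.Cyc p u v
    order₁ {u} {v} u-old v-old su@(pub₁ , ¬pub₂) ¬sv with v ≟ᴾ b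
    ... | yes refl = pub₁
    ... | no v≢b with D₁.cyc? p v b
    ...   | no ¬pvb₁ = D₁.trans-from pub₁ (D₁.swap (p≢old v-old) v≢b (p≢old b-old) ¬pvb₁)
    ...   | yes pvb₁ with D₂.cyc? p v b
    ...     | no ¬pvb₂ = ⊥-elim (¬sv (pvb₁ , ¬pvb₂))
    ...     | yes pvb₂ with D₁.cyc? p u v
    ...       | yes puv₁ = puv₁
    ...       | no ¬puv₁ = ⊥-elim (D₂.anti (ih v-old u-old b-old (D₁.trans-shift pvu₁ pub₁)) (D₂.trans-shift pvb₂ pbu₂))
      where
      pvu₁ : D₁.Cyc p v u
      pvu₁ = D₁.swap (p≢old u-old) (separated-≢ su ¬sv) (p≢old v-old) ¬puv₁
      pbu₂ : D₂.Cyc p b u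
      pbu₂ = D₂.swap (p≢old u-old) (D₁.distinct₂₃ pub₁) (p≢old b-old) ¬pub₂

    order₂ : ∀ {u v} → height u < m → height v < m → Separated u → ¬ Separated v → D₂.Cyc p v u
    order₂ {u} {v} u-old v-old su@(pub₁ , ¬pub₂) ¬sv with v ≟ᴾ b
    ... | yes refl = pbu₂
      where
      pbu₂ : D₂.Cyc p b u
      pbu₂ = D₂.swap (p≢old u-old) (D₁.distinct₂₃ pub₁) (p≢old b-old) ¬pub₂
    ... | no v≢b with D₂.cyc? p v b
    ...   | yes pvb₂ = D₂.trans-from pvb₂ (D₂.swap (p≢old u-old) (D₁.distinct₂₃ pub₁) (p≢old b-old) ¬pub₂)
    ...   | no ¬pvb₂ with D₁.cyc? p v b
    ...     | yes pvb₁ = ⊥-elim (¬sv (pvb₁ , ¬pvb₂))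
    ...     | no ¬pvb₁ with D₂.cyc? p v u
    ...       | yes pvu₂ = pvu₂
    ...       | no ¬pvu₂ = ⊥-elim (D₂.anti (ih u-old b-old v-old (D₁.trans-shift pub₁ pbv₁)) (D₂.rot (D₂.trans-shift pbu₂ puv₂)))
      where
      pbv₁ : D₁.Cyc p b v
      pbv₁ = D₁.swap (p≢old v-old) v≢b (p≢old b-old) ¬pvb₁
      pbu₂ : D₂.Cyc p b u
      pbu₂ = D₂.swap (p≢old u-old) (D₁.distinct₂₃ pub₁) (p≢old b-old) ¬pub₂
      puv₂ : D₂.Cyc p u v
      puv₂ = D₂.swap (p≢old v-old) (λ v≡u → separated-≢ su ¬sv (≡.sym v≡u)) (p≢old u-old) ¬pvu₂

    not-split : ∀ {w e e′} → rank w < m → Separated (w , e) → ¬ Separated (w , e′) → ⊥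
    not-split {w} {e} {e′} w-old s ¬s′ =
      D₂.anti (two-chords (chord-p≢old {w , e} w-old) (endOf p (inj₁ refl)) (endOf (w , e) (inj₂ refl)) (endOf (w , e′) (inj₂ refl))
                 (order₁ w-old w-old s ¬s′))
              (order₂ w-old w-old s ¬s′)

    whole-chord : ∀ {w e e′} → rank w < m → Separated (w , e) → Separated (w , e′)
    whole-chord {w} {e} {e′} w-old s with separated? (w , e′)
    ... | yes s′ = s′
    ... | no ¬s′ = ⊥-elim (not-split w-old s ¬s′)

    unlinked : ∀ {x y} → E G x y → rank x < m → rank y < m → Separated (x , head) → ¬ Separated (y , head) → ⊥
    unlinked {x} {y} xy x-old y-old sx ¬sy = D₁.nested⇒¬cross nested (to (proj₁ i₁ x y x≢y) xy)
      where
      x≢y : x ≢ y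
      x≢y refl = irrefl G xy
      nested : ∀ e e′ → D₁.Cyc p (x , e) (y , e′)
      nested e e′ = order₁ x-old y-old (whole-chord x-old sx) (λ s → ¬sy (whole-chord y-old s))

    side : Fin n → Bool
    side w = does (separated? (w , head))

    side-true : ∀ {w e} → rank w < m → Separated (w , e) → side w ≡ true
    side-true {w} w-old s with separated? (w , head)
    ... | yes _ = refl
    ... | no ¬s = ⊥-elim (¬s (whole-chord w-old s))

    side-false : ∀ {w e} → rank w < m → ¬ Separated (w , e) → side w ≡ false
    side-false {w} w-old ¬s with separated? (w , head)
    ... | yes s = ⊥-elim (¬s (whole-chord w-old s))
    ... | no _  = refl

    side-edge : ∀ {x y} → E G x y → rank x < m → rank y < m → side x ≡ side y
    side-edge {x} {y} xy x-old y-old with separated? (x , head) | separated? (y , head)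
    ... | yes _  | yes _  = refl
    ... | no _   | no _   = refl
    ... | yes sx | no ¬sy = ⊥-elim (unlinked xy x-old y-old sx ¬sy)
    ... | no ¬sx | yes sy = ⊥-elim (unlinked (sym G xy) y-old x-old sy ¬sx)

    true≡false : true ≡ false
    true≡false = begin
      true            ≡⟨ side-true a-old (o₁ , ¬o₂) ⟨
      side (chord a)  ≡⟨ constant-below side m side-edge (chord a) a-old ⟩
      side r          ≡⟨ constant-below side m side-edge (chord b) b-old ⟨
      side (chord b)  ≡⟨ side-false b-old b-unseparated ⟩
      false           ∎
      where
      open ≡.≡-Reasoning
      b-unseparated : ¬ Separated b
      b-unseparated s = D₁.distinct₂₃ (proj₁ s) refl

  extend : ∀ m → AgreeBelow m → ∀ {p a b} → ¬ height p < m → height a < m → height b < m →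
    D₁.Cyc p a b → D₂.Cyc p a b
  extend m ih p-new a-old b-old o₁ with D₂.cyc? _ _ _
  ... | yes o₂ = o₂
  ... | no ¬o₂ with Extension.true≡false m ih p-new a-old b-old o₁ ¬o₂
  ...   | ()

  -- At most one chord has rank exactly m.
  below-if-other : ∀ {m v w} → rank v ≡ m → rank w < suc m → v ≢ w → rank w < m
  below-if-other v≡m w≤m v≢w with ℕₚ.m<1+n⇒m<n∨m≡n w≤m
  ... | inj₁ w<m = w<m
  ... | inj₂ w≡m = ⊥-elim (v≢w (rank-injective (≡.trans v≡m (≡.sym w≡m))))

  step : ∀ m → AgreeBelow m → AgreeBelow (suc m)
  step m ih {a} {b} {c} a≤m b≤m c≤m o
    with chord a Fin.≟ chord b | chord b Fin.≟ chord c | chord a Fin.≟ chord c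
  ... | yes a~b | _      | yes a~c = ⊥-elim (no-three-ends a~b a~c (D₁.distinct₁₂ o) (D₁.distinct₂₃ o) (D₁.distinct₁₃ o))
  ... | yes a~b | _      | no a≁c  =
    two-chords a≁c (endOf a (inj₁ refl)) (endOf b (inj₁ (≡.sym a~b))) (endOf c (inj₂ refl)) o
  ... | no a≁b  | yes b~c | _      =
    two-chords (λ e → a≁b (≡.sym e)) (endOf a (inj₂ refl)) (endOf b (inj₁ refl)) (endOf c (inj₁ (≡.sym b~c))) o
  ... | no a≁b  | no b≁c  | yes a~c =
    two-chords a≁b (endOf a (inj₁ refl)) (endOf b (inj₂ refl)) (endOf c (inj₁ (≡.sym a~c))) o
  ... | no a≁b  | no b≁c  | no a≁c
    with ℕₚ.m<1+n⇒m<n∨m≡n a≤m | ℕₚ.m<1+n⇒m<n∨m≡n b≤m | ℕₚ.m<1+n⇒m<n∨m≡n c≤m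
  ...   | inj₁ a<m | inj₁ b<m | inj₁ c<m = ih a<m b<m c<m o
  ...   | inj₂ a≡m | _        | _        =
    extend m ih (ℕₚ.<-irrefl a≡m) (below-if-other a≡m b≤m a≁b) (below-if-other a≡m c≤m a≁c) o
  ...   | inj₁ a<m | inj₂ b≡m | _        =
    D₂.rot² (extend m ih (ℕₚ.<-irrefl b≡m) (below-if-other b≡m c≤m b≁c) a<m (D₁.rot o))
  ...   | inj₁ a<m | inj₁ b<m | inj₂ c≡m =
    D₂.rot (extend m ih (ℕₚ.<-irrefl c≡m) a<m b<m (D₁.rot² o))

  agree-below : ∀ m → AgreeBelow m
  agree-below zero    ()
  agree-below (suc m) = step m (agree-below m)

  agreement : ∀ {a b c} → D₁.Cyc a b c → D₂.Cyc a b c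
  agreement {a} {b} {c} = agree-below (suc (height a + height b + height c)) a< b< c<
    where
    a< = s≤s (ℕₚ.≤-trans (ℕₚ.m≤m+n (height a) (height b)) (ℕₚ.m≤m+n _ (height c)))
    b< = s≤s (ℕₚ.≤-trans (ℕₚ.m≤n+m (height b) (height a)) (ℕₚ.m≤m+n _ (height c)))
    c< = s≤s (ℕₚ.m≤n+m (height c) (height a + height b))

cyclic-orders-agree : ∀ {n} (G : Graph n) (β : Beta n) (D₁ D₂ : ChordDiagram n) → Connected G →
  IsDiagramFor D₁ G β → IsDiagramFor D₂ G β →
  ∀ {a b c} → DiagramOrder.Cyc D₁ a b c → DiagramOrder.Cyc D₂ a b c
cyclic-orders-agree G β D₁ D₂ connected i₁ i₂ {a} =
  GlobalAgreement.agreement G β D₁ D₂ i₁ i₂ (BreadthFirst.ranking G (adjacency? G D₁ (proj₁ i₁)) connected (proj₁ a))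

-- A duplicate-free list is determined by
-- its linear order, and the cyclic order seen from a point e is the linear
-- order of the rotation starting at e; so two complete duplicate-free lists
-- with the same cyclic order are rotations of each other.
module Rotation {X : Set} where
  open Precedence {X}

  order-determines-list : ∀ (xs ys : List X) → Unique ys →
    (∀ {z} → z ∈ xs → z ∈ ys) → (∀ {z} → z ∈ ys → z ∈ xs) →
    (∀ {a b} → Precedes xs a b → Precedes ys a b) → xs ≡ ys
  order-determines-list []       []       _ _     _     _ = refl
  order-determines-list []       (y ∷ ys) _ _     ys⊆xs _ with ys⊆xs (here refl)
  ... | ()
  order-determines-list (x ∷ xs) []       _ xs⊆ys _     _ with xs⊆ys (here refl)
  ... | ()
  order-determines-list (x ∷ xs) (y ∷ ys) u xs⊆ys ys⊆xs extends with ys⊆xs (here refl)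
  -- y occurs after x in x ∷ xs, hence after x in y ∷ ys: impossible
  ... | there y∈xs with extends (inj₁ (refl , y∈xs))
  ...   | inj₁ (refl , y∈ys) = ⊥-elim (Unique[x∷xs]⇒x∉xs u y∈ys)
  ...   | inj₂ x<y          = ⊥-elim (Unique[x∷xs]⇒x∉xs u (precedes-∈ʳ x<y))
  order-determines-list (x ∷ xs) (.x ∷ ys) u@(_ ∷ u′) xs⊆ys ys⊆xs extends | here refl =
    ≡.cong (x ∷_) (order-determines-list xs ys u′ xs⊆ys′ ys⊆xs′ extends′)
    where
    xs⊆ys′ : ∀ {z} → z ∈ xs → z ∈ ys
    xs⊆ys′ z∈xs with xs⊆ys (there z∈xs)
    ... | there z∈ys = z∈ys
    ... | here refl  = ⊥-elim (precedes-irrefl u (extends (inj₁ (refl , z∈xs))))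
    ys⊆xs′ : ∀ {z} → z ∈ ys → z ∈ xs
    ys⊆xs′ z∈ys with ys⊆xs (there z∈ys)
    ... | there z∈xs = z∈xs
    ... | here refl  = ⊥-elim (Unique[x∷xs]⇒x∉xs u z∈ys)
    extends′ : ∀ {a b} → Precedes xs a b → Precedes ys a b
    extends′ a<b with extends (inj₂ a<b)
    ... | inj₂ a<b′     = a<b′
    ... | inj₁ (refl , _) = ⊥-elim (Unique[x∷xs]⇒x∉xs u (xs⊆ys′ (precedes-∈ˡ a<b)))

  rotated-order : ∀ A B {e a b} → Precedes (B ++ A) a b → Cyclic (Precedes (A ++ e ∷ B)) e a b
  rotated-order A B a<b with precedes-++⁻ B a<b
  ... | inj₁ a<b∈B              = inj₁ (precedes-++ʳ A (inj₁ (refl , precedes-∈ˡ a<b∈B)) , precedes-++ʳ A (inj₂ a<b∈B))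
  ... | inj₂ (inj₁ a<b∈A)       = inj₂ (inj₁ (precedes-++ˡ a<b∈A , precedes-++-across (precedes-∈ʳ a<b∈A) (here refl)))
  ... | inj₂ (inj₂ (a∈B , b∈A)) = inj₂ (inj₂ (precedes-++-across b∈A (here refl) , precedes-++ʳ A (inj₁ (refl , a∈B))))

  nothing-before-head : ∀ {e T b} → Unique (e ∷ T) → ¬ Precedes (e ∷ T) b e
  nothing-before-head u (inj₁ (_ , e∈T)) = Unique[x∷xs]⇒x∉xs u e∈T
  nothing-before-head u (inj₂ b<e)       = Unique[x∷xs]⇒x∉xs u (precedes-∈ʳ b<e)

  order-after-head : ∀ {e T a b} → Unique (e ∷ T) → Cyclic (Precedes (e ∷ T)) e a b → Precedes T a b
  order-after-head u (inj₁ (_ , inj₂ a<b))          = a<b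
  order-after-head u (inj₁ (e<a , inj₁ (refl , _))) = ⊥-elim (precedes-irrefl u e<a)
  order-after-head u (inj₂ (inj₁ (_ , b<e)))        = ⊥-elim (nothing-before-head u b<e)
  order-after-head u (inj₂ (inj₂ (b<e , _)))        = ⊥-elim (nothing-before-head u b<e)

  rotate-length : ∀ (A C : List X) → rotate (length A) (A ++ C) ≡ C ++ A
  rotate-length A C = ≡.cong₂ _++_ (drop-length A) (take-length A)
    where
    drop-length : ∀ A → drop (length A) (A ++ C) ≡ C
    drop-length []      = refl
    drop-length (_ ∷ A) = drop-length A
    take-length : ∀ A → take (length A) (A ++ C) ≡ A
    take-length []      = refl
    take-length (a ∷ A) = ≡.cong (a ∷_) (take-length A)

  -- Two complete duplicate-free lists with the same cyclic order are rotations
  -- of each other: rotate xs to start at the first entry of ys.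
  same-cyclic-order⇒rotation : ∀ (xs ys : List X) → Unique xs → Unique ys →
    (∀ z → z ∈ xs) → (∀ z → z ∈ ys) →
    (∀ {a b c} → Cyclic (Precedes xs) a b c → Cyclic (Precedes ys) a b c) → ∃[ k ] (rotate k xs ≡ ys)
  same-cyclic-order⇒rotation []       []        _  _  _      _      _ = 0 , refl
  same-cyclic-order⇒rotation (x ∷ _)  []        _  _  _      ys-all _ with ys-all x
  ... | ()
  same-cyclic-order⇒rotation xs       (e ∷ ys′) ux uy xs-all ys-all agree with ∈-∃++ (xs-all e)
  ... | A , B , refl = length A , ≡.trans (rotate-length A (e ∷ B))
          (order-determines-list (e ∷ B ++ A) (e ∷ ys′) uy (λ {z} _ → ys-all z) (λ {z} _ → rotated-all z) extends)
    where
    rotated-all : ∀ z → z ∈ e ∷ B ++ A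
    rotated-all z = ∈-resp-↭ (++-comm A (e ∷ B)) (xs-all z)
    e∉B++A : e ∉ B ++ A
    e∉B++A = Unique[x∷xs]⇒x∉xs (PermSetoid.Unique-resp-↭ (≡.setoid X) (↭⇒↭ₛ (++-comm A (e ∷ B))) ux)
    in-ys′ : ∀ z → z ≢ e → z ∈ ys′
    in-ys′ z z≢e with ys-all z
    ... | here z≡e  = ⊥-elim (z≢e z≡e)
    ... | there z∈ys′ = z∈ys′
    extends : ∀ {a b} → Precedes (e ∷ B ++ A) a b → Precedes (e ∷ ys′) a b
    extends (inj₁ (refl , b∈B++A)) = inj₁ (refl , in-ys′ _ λ { refl → e∉B++A b∈B++A })
    extends (inj₂ a<b)             = inj₂ (order-after-head uy (agree (rotated-order A B a<b)))

-- The diagram witnessing chordality is the only one up to equivalence: every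
-- other diagram for (G, β) has the same cyclic order, hence is a rotation of it.
lemma3p4 : ∀ {n : ℕ} (G : Graph n) (β : Beta n) →
    Connected G → NajiSolution G β → Chordal G β →
    Σ (ChordDiagram n) (λ D → IsDiagramFor D G β ×
      (∀ (D′ : ChordDiagram n) → IsDiagramFor D′ G β → Equivalent D′ D))
lemma3p4 G β connected _ (D , isD) = D , isD , λ D′ isD′ →
  Rotation.same-cyclic-order⇒rotation (seq D′) (seq D) (unique D′) (unique D) (complete D′) (complete D)
    (cyclic-orders-agree G β D′ D connected isD′ isD)
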